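{- A cirquent (or formula) is trivial if and only if it is an instance of a binary tautology.
   Context: Formulas: built from infinitely many propositional atoms using $\neg,\wedge,\vee$ (binary), $\neg$ only on atoms; $\neg\neg F$, $\neg(F\wedge G)$, $\neg(F\vee G)$ abbreviate $F$, $\neg F\vee\neg G$, $\neg F\wedge\neg G$. A literal is $P$ or $\neg P$. A $k$-ary cirquent is a pair consisting of a structure (a finite sequence, repetitions allowed, of subsets of $\{1,\dots,k\}$, called groups) and a pool $\langle F_1,\dots,F_k\rangle$ of formulas (oformulas); group $\Gamma$ contains $F_i$ for $i\in\Gamma$; a formula $F$ is identified with the cirquent $(\langle\{1\}\rangle,\langle F\rangle)$. Classical truth: a classical model assigns truth values to atoms, extended classically; a group is true iff some oformula of it is; a cirquent is true iff all its groups are; a tautology is true in every model. A cirquent is binary iff no atom has more than two occurrences in (the oformulas of) it; a binary tautology is a binary cirquent that is a tautology. A substitution maps atoms to formulas, extended by $\sigma(\neg P)=\neg\sigma(P)$ and homomorphically over $\wedge,\vee$, and to cirquents oformula-wise keeping the structure; $B$ is an instance of $A$ iff $B=\sigma(A)$ for some substitution. Resources: a port is an atom $P$ (output) or $-P$ (input), $P$ being its type; an interface is a finite sequence of ports, a situation for it a bit string of the same length; $\mathbf s\le\mathbf s'$ iff $\mathbf s(i)\le\mathbf s'(i)$ at outputs and $\mathbf s'(i)\le\mathbf s(i)$ at inputs; a resource is an interface together with a $\le$-monotone function from its situations to $\{0,1\}$ (value 1 = true). For a cirquent $C$: a situation for $C$ assigns truth values to all atom occurrences in its oformulas; oformulas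 are evaluated by the classical clauses on occurrences ($\neg P$ true iff that occurrence of $P$ is false), groups by disjunction, the cirquent by conjunction of its groups. $C^\clubsuit$ is the resource with interface $\langle\mathrm{Port}(L_1),\dots,\mathrm{Port}(L_n)\rangle$ ($L_1,\dots,L_n$ the literal occurrences of $C$ in order; $\mathrm{Port}(P)=P$, $\mathrm{Port}(\neg P)=-P$) that is true in $\mathbf s$ iff $C$ is true in $\mathbf s$. Triviality: an allocation for a resource $\alpha$ is a pair $(X,Y)$ of an input occurrence $X$ and an output occurrence $Y$ in the interface of $\alpha$ of the same type; an arrangement is a set of allocations; it is monogamous iff no port occurrence is used by more than one of its allocations. A situation $\mathbf s$ is consistent with arrangement $\mathcal A$ iff $\mathbf s(X)\le\mathbf s(Y)$ for all $(X,Y)\in\mathcal A$. $\mathcal A$ is trivializing iff $\alpha$ is true in every situation consistent with $\mathcal A$. $\alpha$ is trivial iff it has a monogamous trivializing arrangement; a cirquent or formula $C$ is trivial iff $C^\clubsuit$ is. -}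

module Defs where

open import Data.Nat using (ℕ; zero; suc; _+_; _≡ᵇ_)
  renaming (_≤_ to _≤ℕ_)
open import Data.Bool using (Bool; true; false; not; if_then_else_)
  renaming (_∧_ to _&&_; _∨_ to _||_; _≤_ to _≤B_)
open import Data.Bool.Properties using () renaming (≤-refl to ≤B-refl)
open import Data.Bool using (b≤b; f≤t)
open import Data.Fin using (Fin)
open import Data.Fin.Subset using (Subset)
open import Data.Vec using (Vec; []; _∷_; _++_; lookup; map)
open import Data.List using (List; []; _∷_; concatMap)
open import Data.List.Relation.Unary.All using (All)
open import Data.List.Relation.Unary.Unique.Propositional using (Unique)
open import Data.Product using (Σ; ∃; _×_; _,_)
open import Relation.Binary.PropositionalEquality using (_≡_; refl)

-- Formulas.  Atoms are natural numbers (infinitely many).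
-- (lit true P) is the literal P, (lit false P) is the literal ¬P.

data Formula : Set where
  lit : Bool → ℕ → Formula
  _∧_ : Formula → Formula → Formula
  _∨_ : Formula → Formula → Formula

neg : Formula → Formula
neg (lit b P) = lit (not b) P
neg (F ∧ G)   = neg F ∨ neg G
neg (F ∨ G)   = neg F ∧ neg G

-- Cirquents: structure = finite sequence of groups (subsets of {1..k}),
-- pool = k formulas (oformulas).

record Cirquent : Set where
  constructor cirq
  field
    arity     : ℕ
    structure : List (Subset arity)
    pool      : Vec Formula arity
open Cirquent public

formulaCirq : Formula → Cirquent
formulaCirq F = cirq 1 ((true ∷ []) ∷ []) (F ∷ [])

groupVal : ∀ {k} → Subset k → Vec Bool k → Bool
groupVal []       []       = false
groupVal (g ∷ Γ) (v ∷ vs) = (g && v) || groupVal Γ vs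

cirqVal : ∀ {k} → List (Subset k) → Vec Bool k → Bool
cirqVal []       vs = true
cirqVal (Γ ∷ Γs) vs = groupVal Γ vs && cirqVal Γs vs

Model : Set
Model = ℕ → Bool

evalM : Model → Formula → Bool
evalM v (lit true P)  = v P
evalM v (lit false P) = not (v P)
evalM v (F ∧ G)       = evalM v F && evalM v G
evalM v (F ∨ G)       = evalM v F || evalM v G

TrueIn : Model → Cirquent → Set
TrueIn v C = cirqVal (structure C) (map (evalM v) (pool C)) ≡ true

Tautology : Cirquent → Set
Tautology C = (v : Model) → TrueIn v C

occ : ℕ → Formula → ℕ
occ P (lit b Q) = if P ≡ᵇ Q then 1 else 0
occ P (F ∧ G)   = occ P F + occ P G
occ P (F ∨ G)   = occ P F + occ P G

occPool : ∀ {k} → ℕ → Vec Formula k → ℕ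
occPool P []       = 0
occPool P (F ∷ Fs) = occ P F + occPool P Fs

Binary : Cirquent → Set
Binary C = (P : ℕ) → occPool P (pool C) ≤ℕ 2

BinaryTautology : Cirquent → Set
BinaryTautology C = Binary C × Tautology C

Substitution : Set
Substitution = ℕ → Formula

applyF : Substitution → Formula → Formula
applyF σ (lit true P)  = σ P
applyF σ (lit false P) = neg (σ P)
applyF σ (F ∧ G)       = applyF σ F ∧ applyF σ G
applyF σ (F ∨ G)       = applyF σ F ∨ applyF σ G

applyC : Substitution → Cirquent → Cirquent
applyC σ (cirq k S Fs) = cirq k S (map (applyF σ) Fs)

InstanceOf : Cirquent → Cirquent → Set
InstanceOf B A = ∃ λ (σ : Substitution) → B ≡ applyC σ A

-- a port: (output? , type); output P = (true , P), input -P = (false , P)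
record Port : Set where
  constructor port
  field
    isOutput : Bool
    type     : ℕ
open Port public

data SitLeq : ∀ {n} → Vec Port n → Vec Bool n → Vec Bool n → Set where
  []  : SitLeq [] [] []
  out : ∀ {n P a b} {ps : Vec Port n} {s s'} →
        a ≤B b → SitLeq ps s s' → SitLeq (port true P ∷ ps) (a ∷ s) (b ∷ s')
  inp : ∀ {n P a b} {ps : Vec Port n} {s s'} →
        b ≤B a → SitLeq ps s s' → SitLeq (port false P ∷ ps) (a ∷ s) (b ∷ s')

record Resource : Set where
  field
    len       : ℕ
    interface : Vec Port len
    value     : Vec Bool len → Bool       -- situations = bit strings
    monotone  : ∀ s s' → SitLeq interface s s' → value s ≤B value s'
open Resource public

size : Formula → ℕ
size (lit _ _) = 1
size (F ∧ G)   = size F + size G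
size (F ∨ G)   = size F + size G

takeV : ∀ {A : Set} m {n} → Vec A (m + n) → Vec A m
takeV zero    xs       = []
takeV (suc m) (x ∷ xs) = x ∷ takeV m xs

dropV : ∀ {A : Set} m {n} → Vec A (m + n) → Vec A n
dropV zero    xs       = xs
dropV (suc m) (x ∷ xs) = dropV m xs

portsF : (F : Formula) → Vec Port (size F)
portsF (lit b P) = port b P ∷ []
portsF (F ∧ G)   = portsF F ++ portsF G
portsF (F ∨ G)   = portsF F ++ portsF G

-- evaluation of an oformula in a situation (truth values of occurrences)
evalS : (F : Formula) → Vec Bool (size F) → Bool
evalS (lit true P)  (x ∷ []) = x
evalS (lit false P) (x ∷ []) = not x
evalS (F ∧ G) s = evalS F (takeV (size F) s) && evalS G (dropV (size F) s)
evalS (F ∨ G) s = evalS F (takeV (size F) s) || evalS G (dropV (size F) s)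

sizeP : ∀ {k} → Vec Formula k → ℕ
sizeP []       = 0
sizeP (F ∷ Fs) = size F + sizeP Fs

portsP : ∀ {k} (Fs : Vec Formula k) → Vec Port (sizeP Fs)
portsP []       = []
portsP (F ∷ Fs) = portsF F ++ portsP Fs

evalP : ∀ {k} (Fs : Vec Formula k) → Vec Bool (sizeP Fs) → Vec Bool k
evalP []       s = []
evalP (F ∷ Fs) s = evalS F (takeV (size F) s) ∷ evalP Fs (dropV (size F) s)

private
  &&-mono : ∀ {a b c d} → a ≤B b → c ≤B d → (a && c) ≤B (b && d)
  &&-mono {false} {false} p q = b≤b
  &&-mono {false} {true} {c} {false} p q = b≤b
  &&-mono {false} {true} {c} {true}  p q = f≤t
  &&-mono {true}  {true}  p q = q

  ||-mono : ∀ {a b c d} → a ≤B b → c ≤B d → (a || c) ≤B (b || d)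
  ||-mono {false} {false} p q = q
  ||-mono {false} {true} {false} {false} p q = f≤t
  ||-mono {false} {true} {false} {true} p q = f≤t
  ||-mono {false} {true} {true} {true} p q = b≤b
  ||-mono {true}  {true}  p q = b≤b

  not-anti : ∀ {a b} → b ≤B a → not a ≤B not b
  not-anti b≤b = b≤b
  not-anti f≤t = f≤t

  split : ∀ {m n} (ps : Vec Port m) {qs : Vec Port n} s s' →
          SitLeq (ps ++ qs) s s' →
          SitLeq ps (takeV m s) (takeV m s') × SitLeq qs (dropV m s) (dropV m s')
  split [] s s' r = [] , r
  split (_ ∷ ps) (a ∷ s) (b ∷ s') (out x r) with split ps s s' r
  ... | r1 , r2 = out x r1 , r2
  split (_ ∷ ps) (a ∷ s) (b ∷ s') (inp x r) with split ps s s' r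
  ... | r1 , r2 = inp x r1 , r2

  evalS-mono : (F : Formula) → ∀ s s' → SitLeq (portsF F) s s' →
               evalS F s ≤B evalS F s'
  evalS-mono (lit true P)  (a ∷ []) (b ∷ []) (out x []) = x
  evalS-mono (lit false P) (a ∷ []) (b ∷ []) (inp x []) = not-anti x
  evalS-mono (F ∧ G) s s' r with split (portsF F) s s' r
  ... | r1 , r2 = &&-mono (evalS-mono F _ _ r1) (evalS-mono G _ _ r2)
  evalS-mono (F ∨ G) s s' r with split (portsF F) s s' r
  ... | r1 , r2 = ||-mono (evalS-mono F _ _ r1) (evalS-mono G _ _ r2)

  data VLeq : ∀ {k} → Vec Bool k → Vec Bool k → Set where
    []  : VLeq [] []
    _∷_ : ∀ {k a b} {u v : Vec Bool k} → a ≤B b → VLeq u v → VLeq (a ∷ u) (b ∷ v)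

  evalP-mono : ∀ {k} (Fs : Vec Formula k) s s' → SitLeq (portsP Fs) s s' →
               VLeq (evalP Fs s) (evalP Fs s')
  evalP-mono [] [] [] [] = []
  evalP-mono (F ∷ Fs) s s' r with split (portsF F) s s' r
  ... | r1 , r2 = evalS-mono F _ _ r1 ∷ evalP-mono Fs _ _ r2

  groupVal-mono : ∀ {k} (Γ : Subset k) {u v} → VLeq u v →
                  groupVal Γ u ≤B groupVal Γ v
  groupVal-mono [] [] = b≤b
  groupVal-mono (g ∷ Γ) (x ∷ r) = ||-mono (&&-mono (≤B-refl {g}) x) (groupVal-mono Γ r)

  cirqVal-mono : ∀ {k} (Γs : List (Subset k)) {u v} → VLeq u v →
                 cirqVal Γs u ≤B cirqVal Γs v
  cirqVal-mono []       r = b≤b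
  cirqVal-mono (Γ ∷ Γs) r = &&-mono (groupVal-mono Γ r) (cirqVal-mono Γs r)

clubsuit : Cirquent → Resource
clubsuit (cirq k S Fs) = record
  { len       = sizeP Fs
  ; interface = portsP Fs
  ; value     = λ s → cirqVal S (evalP Fs s)
  ; monotone  = λ s s' r → cirqVal-mono S (evalP-mono Fs s s' r)
  }

module _ (α : Resource) where

  IsAllocation : Fin (len α) × Fin (len α) → Set
  IsAllocation (X , Y) =
    isOutput (lookup (interface α) X) ≡ false ×
    isOutput (lookup (interface α) Y) ≡ true ×
    type (lookup (interface α) X) ≡ type (lookup (interface α) Y)

  -- an arrangement (finite set of allocations), given as a list
  Arrangement : Set
  Arrangement = List (Fin (len α) × Fin (len α))

  usedPorts : Arrangement → List (Fin (len α))
  usedPorts = concatMap (λ { (X , Y) → X ∷ Y ∷ [] })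

  Monogamous : Arrangement → Set
  Monogamous 𝒜 = Unique (usedPorts 𝒜)

  ConsistentWith : Vec Bool (len α) → Arrangement → Set
  ConsistentWith s 𝒜 = All (λ { (X , Y) → lookup s X ≤B lookup s Y }) 𝒜

  Trivializing : Arrangement → Set
  Trivializing 𝒜 = ∀ s → ConsistentWith s 𝒜 → value α s ≡ true

  TrivialR : Set
  TrivialR = Σ Arrangement λ 𝒜 →
    All IsAllocation 𝒜 × Monogamous 𝒜 × Trivializing 𝒜

Trivial : Cirquent → Set
Trivial C = TrivialR (clubsuit C)

{-# OPTIONS --safe #-}
module Submission where

-- Both sides are equivalent to the existence of a naming of the ports of C♣: a labelling in
-- which equally named ports have the same type, no name labels more than two ports, and C♣
-- is true in every situation giving equally named ports equal values.
--
-- Given a monogamous trivializing arrangement, name each port after the input it is allocated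
-- to (itself if unallocated); a situation is then consistent with the arrangement as soon as
-- it is constant on names. Given a naming by numbers, replacing the atom of each literal
-- occurrence by its name yields a binary tautology, of which C is the instance obtained by
-- sending every name to the atom of its type.
--
-- Conversely, if C = σ(A) with A a binary tautology, name the i-th literal occurrence of σ(a)
-- inside an occurrence of a or ¬a by (a, i): every name occurs at most as often as a does in
-- A, and a valuation of names induces a model of A. Given a naming, allocate each input to
-- every output of the same name; by monotonicity of C♣ it suffices that each situation
-- consistent with this arrangement dominates one induced by a valuation of names.

open import Defs
import Data.Bool as Bool
open import Data.Bool using (Bool; true; false; not; T; b≤b; f≤t)
  renaming (_∧_ to _&&_; _∨_ to _||_; _≤_ to _≤B_)
open import Data.Bool.Properties using (∨-∧-booleanAlgebra; not-involutive; T-≡)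
  renaming (≤-reflexive to ≤B-reflexive)
open import Algebra.Lattice.Properties.BooleanAlgebra ∨-∧-booleanAlgebra
  using (deMorgan₁; deMorgan₂)
open import Data.Empty using (⊥-elim)
open import Data.Fin as Fin using (Fin; zero; suc; toℕ)
open import Data.Fin.Properties using (any?; toℕ-injective; 0≢1+n; suc-injective)
open import Data.List using (List; _∷_; []; filter; cartesianProduct; allFin)
open import Data.List.Membership.Propositional using (_∈_; _∉_; lose)
open import Data.List.Membership.Propositional.Properties
  using (∈-concatMap⁺; ∈-filter⁺; ∈-cartesianProduct⁺; ∈-allFin)
open import Data.List.Relation.Binary.Disjoint.Propositional using (Disjoint)
open import Data.List.Relation.Unary.All as All using (All)
import Data.List.Relation.Unary.All.Properties as All
open import Data.List.Relation.Unary.AllPairs using (AllPairs; []; _∷_)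
import Data.List.Relation.Unary.AllPairs.Properties as AllPairs
open import Data.List.Relation.Unary.Any using (here; there)
open import Data.List.Relation.Unary.Unique.Propositional using (Unique)
import Data.List.Relation.Unary.Unique.Propositional.Properties as Unique
open import Data.Nat as ℕ using (ℕ; _+_; _≤_; z≤n; s≤s)
open import Data.Nat.Properties using (≤-trans; ≤-reflexive; m≤n+m; +-mono-≤; ≡⇒≡ᵇ)
open import Data.Product using (Σ; _×_; _,_; proj₁; proj₂)
open import Data.Product.Properties using (≡-dec)
open import Data.Sum using (_⊎_; inj₁; inj₂)
open import Data.Vec using (Vec; []; _∷_; _++_; lookup; map; tabulate; count)
open import Data.Vec.Properties
  using (map-++; lookup-map; ∷-injective; lookup∘tabulate; tabulate∘lookup; tabulate-∘)
open import Function using (_∘_)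
open import Function.Bundles using (_⇔_; mk⇔; Equivalence)
open import Level using (0ℓ)
open import Relation.Binary.Core using (Rel)
open import Relation.Binary.Definitions using (DecidableEquality)
open import Relation.Binary.PropositionalEquality
  using (_≡_; _≢_; refl; sym; trans; cong; cong₂; subst; module ≡-Reasoning)
open import Relation.Nullary using (¬_; yes; no; does)
open import Relation.Nullary.Decidable using (isYes; _×-dec_; toWitness; fromWitness)
open import Relation.Unary using (Pred; Decidable)

private variable
  A B C : Set
  k m n : ℕ

takeV-++ : (xs : Vec A m) (ys : Vec A n) → takeV m (xs ++ ys) ≡ xs
takeV-++ []       ys = refl
takeV-++ (x ∷ xs) ys = cong (x ∷_) (takeV-++ xs ys)

dropV-++ : (xs : Vec A m) (ys : Vec A n) → dropV m (xs ++ ys) ≡ ys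
dropV-++ []       ys = refl
dropV-++ (x ∷ xs) ys = dropV-++ xs ys

takeV-++-dropV : ∀ m (xs : Vec A (m + n)) → takeV m xs ++ dropV m xs ≡ xs
takeV-++-dropV ℕ.zero    xs       = refl
takeV-++-dropV (ℕ.suc m) (x ∷ xs) = cong (x ∷_) (takeV-++-dropV m xs)

takeV-map : ∀ (f : A → B) m (xs : Vec A (m + n)) → takeV m (map f xs) ≡ map f (takeV m xs)
takeV-map f ℕ.zero    xs       = refl
takeV-map f (ℕ.suc m) (x ∷ xs) = cong (f x ∷_) (takeV-map f m xs)

dropV-map : ∀ (f : A → B) m (xs : Vec A (m + n)) → dropV m (map f xs) ≡ map f (dropV m xs)
dropV-map f ℕ.zero    xs       = refl
dropV-map f (ℕ.suc m) (x ∷ xs) = dropV-map f m xs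

map-≡-++⁻ : ∀ {f : A → C} {g : B → C} m (xs : Vec A (m + n)) (ys : Vec B m) {zs} →
            map f xs ≡ map g (ys ++ zs) →
            map f (takeV m xs) ≡ map g ys × map f (dropV m xs) ≡ map g zs
map-≡-++⁻ ℕ.zero    xs       []       eq = refl , eq
map-≡-++⁻ (ℕ.suc m) (x ∷ xs) (y ∷ ys) eq with ∷-injective eq
... | fx≡gy , eq′ with map-≡-++⁻ m xs ys eq′
...   | eqˡ , eqʳ = cong₂ _∷_ fx≡gy eqˡ , eqʳ

map-≡-++⁺ : ∀ {f : A → C} {g : B → C} {xs : Vec A m} {ys : Vec B m}
              {xs′ : Vec A n} {ys′ : Vec B n} →
            map f xs ≡ map g ys → map f xs′ ≡ map g ys′ →
            map f (xs ++ xs′) ≡ map g (ys ++ ys′)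
map-≡-++⁺ {f = f} {g} {xs} {ys} {xs′} {ys′} eq eq′ =
  trans (map-++ f xs xs′) (trans (cong₂ _++_ eq eq′) (sym (map-++ g ys ys′)))

map-≡-lookup : ∀ {f : A → C} {g : B → C} {xs : Vec A n} {ys : Vec B n} →
               (∀ i → f (lookup xs i) ≡ g (lookup ys i)) → map f xs ≡ map g ys
map-≡-lookup {xs = []}     {[]}     eq = refl
map-≡-lookup {xs = x ∷ xs} {y ∷ ys} eq = cong₂ _∷_ (eq zero) (map-≡-lookup (eq ∘ suc))

lookup-≡-map : ∀ {f : A → C} {g : B → C} {xs : Vec A n} {ys : Vec B n} →
               map f xs ≡ map g ys → ∀ i → f (lookup xs i) ≡ g (lookup ys i)
lookup-≡-map {f = f} {g} {xs} {ys} eq i =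
  trans (sym (lookup-map i f xs)) (trans (cong (λ zs → lookup zs i) eq) (lookup-map i g ys))

AtMostOne : Pred (Fin n) 0ℓ → Set
AtMostOne P = ∀ i j → P i → P j → i ≡ j

AtMostTwo : Pred (Fin n) 0ℓ → Set
AtMostTwo P = ∀ i j k → P i → P j → P k → i ≡ j ⊎ i ≡ k ⊎ j ≡ k

AtMostTwo-third : ∀ {P : Pred (Fin n) 0ℓ} → AtMostTwo P →
                  ∀ {i j k} → P i → P j → P k → i ≢ j → i ≢ k → j ≡ k
AtMostTwo-third two pi pj pk i≢j i≢k with two _ _ _ pi pj pk
... | inj₁ i≡j        = ⊥-elim (i≢j i≡j)
... | inj₂ (inj₁ i≡k) = ⊥-elim (i≢k i≡k)
... | inj₂ (inj₂ j≡k) = j≡k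

AtMostTwo-⊎ : ∀ {P Q : Pred (Fin n) 0ℓ} → AtMostOne P → AtMostOne Q →
              AtMostTwo (λ i → P i ⊎ Q i)
AtMostTwo-⊎ p q i j k (inj₁ pi) (inj₁ pj) _         = inj₁ (p i j pi pj)
AtMostTwo-⊎ p q i j k (inj₁ pi) (inj₂ _)  (inj₁ pk) = inj₂ (inj₁ (p i k pi pk))
AtMostTwo-⊎ p q i j k (inj₁ _)  (inj₂ qj) (inj₂ qk) = inj₂ (inj₂ (q j k qj qk))
AtMostTwo-⊎ p q i j k (inj₂ qi) (inj₁ pj) (inj₁ pk) = inj₂ (inj₂ (p j k pj pk))
AtMostTwo-⊎ p q i j k (inj₂ qi) (inj₁ _)  (inj₂ qk) = inj₂ (inj₁ (q i k qi qk))
AtMostTwo-⊎ p q i j k (inj₂ qi) (inj₂ qj) _         = inj₁ (q i j qi qj)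

module _ {P : Pred A 0ℓ} (P? : Decidable P) where

  count-++ : (xs : Vec A m) (ys : Vec A n) → count P? (xs ++ ys) ≡ count P? xs + count P? ys
  count-++ []       ys = refl
  count-++ (x ∷ xs) ys with does (P? x)
  ... | true  = cong ℕ.suc (count-++ xs ys)
  ... | false = count-++ xs ys

  count-++-≤ : (xs : Vec A m) (ys : Vec A n) → ∀ {a b} →
               count P? xs ≤ a → count P? ys ≤ b → count P? (xs ++ ys) ≤ a + b
  count-++-≤ xs ys xs≤a ys≤b =
    ≤-trans (≤-reflexive (count-++ xs ys)) (+-mono-≤ xs≤a ys≤b)

  count-takeV-dropV : ∀ m (xs : Vec A (m + n)) →
                      count P? xs ≡ count P? (takeV m xs) + count P? (dropV m xs)
  count-takeV-dropV m xs =
    trans (cong (count P?) (sym (takeV-++-dropV m xs))) (count-++ (takeV m xs) (dropV m xs))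

  count-∷-≤ : ∀ x (xs : Vec A n) → count P? xs ≤ count P? (x ∷ xs)
  count-∷-≤ x xs with does (P? x)
  ... | true  = m≤n+m _ 1
  ... | false = ≤-reflexive refl

  count-∷-yes : ∀ {x} (xs : Vec A n) → P x → count P? (x ∷ xs) ≡ ℕ.suc (count P? xs)
  count-∷-yes {x = x} xs px with P? x
  ... | yes _  = refl
  ... | no ¬px = ⊥-elim (¬px px)

  count≡0 : (xs : Vec A n) → (∀ i → ¬ P (lookup xs i)) → count P? xs ≡ 0
  count≡0 []       none = refl
  count≡0 (x ∷ xs) none with P? x
  ... | yes px = ⊥-elim (none zero px)
  ... | no  _  = count≡0 xs (none ∘ suc)

  count≤1 : (xs : Vec A n) → AtMostOne (P ∘ lookup xs) → count P? xs ≤ 1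
  count≤1 []       one = z≤n
  count≤1 (x ∷ xs) one with P? x
  ... | yes px = s≤s (≤-reflexive (count≡0 xs (λ i pi → 0≢1+n (one zero (suc i) px pi))))
  ... | no  _  = count≤1 xs (λ i j pi pj → suc-injective (one (suc i) (suc j) pi pj))

  count≤2 : (xs : Vec A n) → AtMostTwo (P ∘ lookup xs) → count P? xs ≤ 2
  count≤2 []       two = z≤n
  count≤2 (x ∷ xs) two with P? x
  ... | yes px = s≤s (count≤1 xs λ i j pi pj →
                   suc-injective (AtMostTwo-third two px pi pj 0≢1+n 0≢1+n))
  ... | no  _  = count≤2 xs λ i j k pi pj pk → shift (two (suc i) (suc j) (suc k) pi pj pk)
    where
    shift : ∀ {i j k : Fin n} → suc i ≡ suc j ⊎ suc i ≡ suc k ⊎ suc j ≡ suc k →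
            i ≡ j ⊎ i ≡ k ⊎ j ≡ k
    shift (inj₁ eq)        = inj₁ (suc-injective eq)
    shift (inj₂ (inj₁ eq)) = inj₂ (inj₁ (suc-injective eq))
    shift (inj₂ (inj₂ eq)) = inj₂ (inj₂ (suc-injective eq))

  1≤count : (xs : Vec A n) (i : Fin n) → P (lookup xs i) → 1 ≤ count P? xs
  1≤count (x ∷ xs) zero    pi = subst (1 ≤_) (sym (count-∷-yes xs pi)) (s≤s z≤n)
  1≤count (x ∷ xs) (suc i) pi = ≤-trans (1≤count xs i pi) (count-∷-≤ x xs)

  2≤count : (xs : Vec A n) (i j : Fin n) → i ≢ j →
            P (lookup xs i) → P (lookup xs j) → 2 ≤ count P? xs
  2≤count (x ∷ xs) zero    zero    i≢j _  _  = ⊥-elim (i≢j refl)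
  2≤count (x ∷ xs) zero    (suc j) _   pi pj =
    subst (2 ≤_) (sym (count-∷-yes xs pi)) (s≤s (1≤count xs j pj))
  2≤count (x ∷ xs) (suc i) zero    _   pi pj =
    subst (2 ≤_) (sym (count-∷-yes xs pj)) (s≤s (1≤count xs i pi))
  2≤count (x ∷ xs) (suc i) (suc j) i≢j pi pj =
    ≤-trans (2≤count xs i j (i≢j ∘ cong suc) pi pj) (count-∷-≤ x xs)

  3≤count : (xs : Vec A n) (i j k : Fin n) → i ≢ j → i ≢ k → j ≢ k →
            P (lookup xs i) → P (lookup xs j) → P (lookup xs k) → 3 ≤ count P? xs
  3≤count (x ∷ xs) zero    zero    _       i≢j _   _   _  _  _  = ⊥-elim (i≢j refl)
  3≤count (x ∷ xs) zero    (suc j) zero    _   i≢k _   _  _  _  = ⊥-elim (i≢k refl)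
  3≤count (x ∷ xs) (suc i) zero    zero    _   _   j≢k _  _  _  = ⊥-elim (j≢k refl)
  3≤count (x ∷ xs) zero    (suc j) (suc k) _   _   j≢k pi pj pk =
    subst (3 ≤_) (sym (count-∷-yes xs pi)) (s≤s (2≤count xs j k (j≢k ∘ cong suc) pj pk))
  3≤count (x ∷ xs) (suc i) zero    (suc k) _   i≢k _   pi pj pk =
    subst (3 ≤_) (sym (count-∷-yes xs pj)) (s≤s (2≤count xs i k (i≢k ∘ cong suc) pi pk))
  3≤count (x ∷ xs) (suc i) (suc j) zero    i≢j _   _   pi pj pk =
    subst (3 ≤_) (sym (count-∷-yes xs pk)) (s≤s (2≤count xs i j (i≢j ∘ cong suc) pi pj))
  3≤count (x ∷ xs) (suc i) (suc j) (suc k) i≢j i≢k j≢k pi pj pk =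
    ≤-trans (3≤count xs i j k (i≢j ∘ cong suc) (i≢k ∘ cong suc) (j≢k ∘ cong suc)
                     pi pj pk)
            (count-∷-≤ x xs)

  count≤2⇔AtMostTwo : (xs : Vec A n) → count P? xs ≤ 2 ⇔ AtMostTwo (P ∘ lookup xs)
  count≤2⇔AtMostTwo xs = mk⇔ atMostTwo (count≤2 xs)
    where
    atMostTwo : count P? xs ≤ 2 → AtMostTwo (P ∘ lookup xs)
    atMostTwo c≤2 i j k pi pj pk with i Fin.≟ j | i Fin.≟ k | j Fin.≟ k
    ... | yes i≡j | _       | _       = inj₁ i≡j
    ... | no _    | yes i≡k | _       = inj₂ (inj₁ i≡k)
    ... | no _    | no _    | yes j≡k = inj₂ (inj₂ j≡k)
    ... | no i≢j  | no i≢k  | no j≢k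
      with ≤-trans (3≤count xs i j k i≢j i≢k j≢k pi pj pk) c≤2
    ...   | s≤s (s≤s ())

≤B-true : ∀ {a b} → a ≤B b → a ≡ true → b ≡ true
≤B-true b≤b a≡true = a≡true
≤B-true f≤t _      = refl

≤B-intro : ∀ {a b} → (a ≡ true → b ≡ true) → a ≤B b
≤B-intro {false} {false} _ = b≤b
≤B-intro {false} {true}  _ = f≤t
≤B-intro {true}          h with h refl
... | refl = b≤b

SitLeq-intro : (ps : Vec Port n) {s t : Vec Bool n} →
               (∀ i → isOutput (lookup ps i) ≡ true  → lookup s i ≤B lookup t i) →
               (∀ i → isOutput (lookup ps i) ≡ false → lookup t i ≤B lookup s i) →
               SitLeq ps s t
SitLeq-intro [] {[]} {[]} _ _ = []
SitLeq-intro (port true  P ∷ ps) {_ ∷ _} {_ ∷ _} outs ins =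
  out (outs zero refl) (SitLeq-intro ps (outs ∘ suc) (ins ∘ suc))
SitLeq-intro (port false P ∷ ps) {_ ∷ _} {_ ∷ _} outs ins =
  inp (ins zero refl) (SitLeq-intro ps (outs ∘ suc) (ins ∘ suc))

evalS-∧-++ : ∀ F G (xs : Vec Bool (size F)) (ys : Vec Bool (size G)) →
             evalS (F ∧ G) (xs ++ ys) ≡ evalS F xs && evalS G ys
evalS-∧-++ F G xs ys =
  cong₂ _&&_ (cong (evalS F) (takeV-++ xs ys)) (cong (evalS G) (dropV-++ xs ys))

evalS-∨-++ : ∀ F G (xs : Vec Bool (size F)) (ys : Vec Bool (size G)) →
             evalS (F ∨ G) (xs ++ ys) ≡ evalS F xs || evalS G ys
evalS-∨-++ F G xs ys =
  cong₂ _||_ (cong (evalS F) (takeV-++ xs ys)) (cong (evalS G) (dropV-++ xs ys))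

evalP-∷-++ : ∀ F (Fs : Vec Formula k) (xs : Vec Bool (size F)) (ys : Vec Bool (sizeP Fs)) →
             evalP (F ∷ Fs) (xs ++ ys) ≡ evalS F xs ∷ evalP Fs ys
evalP-∷-++ F Fs xs ys =
  cong₂ _∷_ (cong (evalS F) (takeV-++ xs ys)) (cong (evalP Fs) (dropV-++ xs ys))

-- The identity along size (neg G) ≡ size G, by recursion on G rather than via a cast, so that
-- it splits exactly like portsF and evalS do.
castNeg : ∀ G → Vec A (size G) → Vec A (size (neg G))
castNeg (lit b P) xs = xs
castNeg (F ∧ G)   xs = castNeg F (takeV (size F) xs) ++ castNeg G (dropV (size F) xs)
castNeg (F ∨ G)   xs = castNeg F (takeV (size F) xs) ++ castNeg G (dropV (size F) xs)

evalS-neg : ∀ G (s : Vec Bool (size G)) → evalS (neg G) (castNeg G s) ≡ not (evalS G s)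
evalS-neg (lit true  P) (x ∷ []) = refl
evalS-neg (lit false P) (x ∷ []) = sym (not-involutive x)
evalS-neg (F ∧ G) s = begin
  evalS (neg F ∨ neg G) (castNeg F s₁ ++ castNeg G s₂)
    ≡⟨ evalS-∨-++ (neg F) (neg G) _ _ ⟩
  evalS (neg F) (castNeg F s₁) || evalS (neg G) (castNeg G s₂)
    ≡⟨ cong₂ _||_ (evalS-neg F s₁) (evalS-neg G s₂) ⟩
  not (evalS F s₁) || not (evalS G s₂)
    ≡⟨ deMorgan₁ (evalS F s₁) (evalS G s₂) ⟨
  not (evalS F s₁ && evalS G s₂)
    ∎
  where
  open ≡-Reasoning
  s₁ = takeV (size F) s
  s₂ = dropV (size F) s
evalS-neg (F ∨ G) s = begin
  evalS (neg F ∧ neg G) (castNeg F s₁ ++ castNeg G s₂)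
    ≡⟨ evalS-∧-++ (neg F) (neg G) _ _ ⟩
  evalS (neg F) (castNeg F s₁) && evalS (neg G) (castNeg G s₂)
    ≡⟨ cong₂ _&&_ (evalS-neg F s₁) (evalS-neg G s₂) ⟩
  not (evalS F s₁) && not (evalS G s₂)
    ≡⟨ deMorgan₂ (evalS F s₁) (evalS G s₂) ⟨
  not (evalS F s₁ || evalS G s₂)
    ∎
  where
  open ≡-Reasoning
  s₁ = takeV (size F) s
  s₂ = dropV (size F) s

map-castNeg : ∀ (f : A → B) G (xs : Vec A (size G)) →
              map f (castNeg G xs) ≡ castNeg G (map f xs)
map-castNeg f (lit b P) xs = refl
map-castNeg f (F ∧ G) xs
  rewrite map-++ f (castNeg F (takeV (size F) xs)) (castNeg G (dropV (size F) xs))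
        | takeV-map f (size F) xs | dropV-map f (size F) xs
  = cong₂ _++_ (map-castNeg f F _) (map-castNeg f G _)
map-castNeg f (F ∨ G) xs
  rewrite map-++ f (castNeg F (takeV (size F) xs)) (castNeg G (dropV (size F) xs))
        | takeV-map f (size F) xs | dropV-map f (size F) xs
  = cong₂ _++_ (map-castNeg f F _) (map-castNeg f G _)

types-neg : ∀ G → map type (portsF (neg G)) ≡ castNeg G (map type (portsF G))
types-neg (lit b P) = refl
types-neg (F ∧ G)
  rewrite map-++ type (portsF F) (portsF G)
        | takeV-++ (map type (portsF F)) (map type (portsF G))
        | dropV-++ (map type (portsF F)) (map type (portsF G))
  = trans (map-++ type (portsF (neg F)) (portsF (neg G)))
          (cong₂ _++_ (types-neg F) (types-neg G))
types-neg (F ∨ G)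
  rewrite map-++ type (portsF F) (portsF G)
        | takeV-++ (map type (portsF F)) (map type (portsF G))
        | dropV-++ (map type (portsF F)) (map type (portsF G))
  = trans (map-++ type (portsF (neg F)) (portsF (neg G)))
          (cong₂ _++_ (types-neg F) (types-neg G))

count-castNeg : ∀ {P : Pred A 0ℓ} (P? : Decidable P) G (xs : Vec A (size G)) →
                count P? (castNeg G xs) ≡ count P? xs
count-castNeg P? (lit b P) xs = refl
count-castNeg P? (F ∧ G) xs =
  trans (count-++ P? (castNeg F _) (castNeg G _))
        (trans (cong₂ _+_ (count-castNeg P? F _) (count-castNeg P? G _))
               (sym (count-takeV-dropV P? (size F) xs)))
count-castNeg P? (F ∨ G) xs =
  trans (count-++ P? (castNeg F _) (castNeg G _))
        (trans (cong₂ _+_ (count-castNeg P? F _) (count-castNeg P? G _))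
               (sym (count-takeV-dropV P? (size F) xs)))

relabelF : (F : Formula) → Vec ℕ (size F) → Formula
relabelF (lit b P) (n ∷ []) = lit b n
relabelF (F ∧ G)   ns       = relabelF F (takeV (size F) ns) ∧ relabelF G (dropV (size F) ns)
relabelF (F ∨ G)   ns       = relabelF F (takeV (size F) ns) ∨ relabelF G (dropV (size F) ns)

relabelP : (Fs : Vec Formula k) → Vec ℕ (sizeP Fs) → Vec Formula k
relabelP []       ns = []
relabelP (F ∷ Fs) ns = relabelF F (takeV (size F) ns) ∷ relabelP Fs (dropV (size F) ns)

evalM-relabelF : ∀ v F (ns : Vec ℕ (size F)) → evalM v (relabelF F ns) ≡ evalS F (map v ns)
evalM-relabelF v (lit true  P) (n ∷ []) = refl
evalM-relabelF v (lit false P) (n ∷ []) = refl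
evalM-relabelF v (F ∧ G) ns rewrite takeV-map v (size F) ns | dropV-map v (size F) ns =
  cong₂ _&&_ (evalM-relabelF v F _) (evalM-relabelF v G _)
evalM-relabelF v (F ∨ G) ns rewrite takeV-map v (size F) ns | dropV-map v (size F) ns =
  cong₂ _||_ (evalM-relabelF v F _) (evalM-relabelF v G _)

evalM-relabelP : ∀ v (Fs : Vec Formula k) ns →
                 map (evalM v) (relabelP Fs ns) ≡ evalP Fs (map v ns)
evalM-relabelP v []       ns = refl
evalM-relabelP v (F ∷ Fs) ns rewrite takeV-map v (size F) ns | dropV-map v (size F) ns =
  cong₂ _∷_ (evalM-relabelF v F _) (evalM-relabelP v Fs _)

occ-relabelF : ∀ P F (ns : Vec ℕ (size F)) → occ P (relabelF F ns) ≡ count (P ℕ.≟_) ns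
occ-relabelF P (lit b Q) (n ∷ []) with P ℕ.≡ᵇ n
... | true  = refl
... | false = refl
occ-relabelF P (F ∧ G) ns =
  trans (cong₂ _+_ (occ-relabelF P F _) (occ-relabelF P G _))
        (sym (count-takeV-dropV (P ℕ.≟_) (size F) ns))
occ-relabelF P (F ∨ G) ns =
  trans (cong₂ _+_ (occ-relabelF P F _) (occ-relabelF P G _))
        (sym (count-takeV-dropV (P ℕ.≟_) (size F) ns))

occPool-relabelP : ∀ P (Fs : Vec Formula k) ns →
                   occPool P (relabelP Fs ns) ≡ count (P ℕ.≟_) ns
occPool-relabelP P []       [] = refl
occPool-relabelP P (F ∷ Fs) ns =
  trans (cong₂ _+_ (occ-relabelF P F _) (occPool-relabelP P Fs _))
        (sym (count-takeV-dropV (P ℕ.≟_) (size F) ns))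

typeAtom : Port → Formula
typeAtom p = lit true (type p)

applyF-relabelF : ∀ σ F (ns : Vec ℕ (size F)) →
                  map σ ns ≡ map typeAtom (portsF F) → applyF σ (relabelF F ns) ≡ F
applyF-relabelF σ (lit true  P) (n ∷ []) eq = proj₁ (∷-injective eq)
applyF-relabelF σ (lit false P) (n ∷ []) eq = cong neg (proj₁ (∷-injective eq))
applyF-relabelF σ (F ∧ G) ns eq with map-≡-++⁻ (size F) ns (portsF F) eq
... | eqF , eqG = cong₂ _∧_ (applyF-relabelF σ F _ eqF) (applyF-relabelF σ G _ eqG)
applyF-relabelF σ (F ∨ G) ns eq with map-≡-++⁻ (size F) ns (portsF F) eq
... | eqF , eqG = cong₂ _∨_ (applyF-relabelF σ F _ eqF) (applyF-relabelF σ G _ eqG)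

applyP-relabelP : ∀ σ (Fs : Vec Formula k) ns →
                  map σ ns ≡ map typeAtom (portsP Fs) → map (applyF σ) (relabelP Fs ns) ≡ Fs
applyP-relabelP σ []       ns eq = refl
applyP-relabelP σ (F ∷ Fs) ns eq with map-≡-++⁻ (size F) ns (portsF F) eq
... | eqF , eqFs = cong₂ _∷_ (applyF-relabelF σ F _ eqF) (applyP-relabelP σ Fs _ eqFs)

ends : A × A → List A
ends (X , Y) = X ∷ Y ∷ []

allPairs-filter⁺ : ∀ {P : Pred A 0ℓ} (P? : Decidable P) {R : Rel A 0ℓ} →
                   (∀ {x y} → x ≢ y → P x → P y → R x y) →
                   ∀ {xs} → Unique xs → AllPairs R (filter P? xs)
allPairs-filter⁺ P? r {[]}     []         = []
allPairs-filter⁺ P? r {x ∷ xs} (x∉ ∷ xs!) with P? x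
... | yes px = All.zipWith (λ (rxy , py) → rxy py)
                 (All.filter⁺ P? (All.map (λ x≢y → r x≢y px) x∉) , All.all-filter P? xs)
               ∷ allPairs-filter⁺ P? r xs!
... | no  _  = allPairs-filter⁺ P? r xs!

module _ (α : Resource) where

  portType : Fin (len α) → ℕ
  portType i = type (lookup (interface α) i)

  IsInput IsOutput : Fin (len α) → Set
  IsInput  i = isOutput (lookup (interface α) i) ≡ false
  IsOutput i = isOutput (lookup (interface α) i) ≡ true

  isInput? : Decidable IsInput
  isInput? i = isOutput (lookup (interface α) i) Bool.≟ false

  isOutput? : Decidable IsOutput
  isOutput? i = isOutput (lookup (interface α) i) Bool.≟ true

  input≢output : ∀ {i j} → IsInput i → IsOutput j → i ≢ j
  input≢output i-in j-out refl with trans (sym i-in) j-out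
  ... | ()

  record Naming (𝒩 : Set) : Set where
    field
      names        : Vec 𝒩 (len α)
      typed        : ∀ i j → lookup names i ≡ lookup names j → portType i ≡ portType j
      atMostTwice  : ∀ x → AtMostTwo (λ i → x ≡ lookup names i)
      tautological : ∀ (v : 𝒩 → Bool) → value α (map v names) ≡ true

module _ {α : Resource} where

  port∈usedPorts : ∀ {𝒜 p Z} → p ∈ 𝒜 → Z ∈ ends p → Z ∈ usedPorts α 𝒜
  port∈usedPorts m z = ∈-concatMap⁺ _ (lose m z)

  monogamous-shared-port : ∀ {𝒜} → Monogamous α 𝒜 → ∀ {p q Z} →
                           p ∈ 𝒜 → q ∈ 𝒜 → Z ∈ ends p → Z ∈ ends q → p ≡ q
  monogamous-shared-port {(X , Y) ∷ 𝒜} (X∉ ∷ Y∉ ∷ mono) = shared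
    where
    fresh : ∀ {Z} → Z ∈ X ∷ Y ∷ [] → Z ∉ usedPorts α 𝒜
    fresh (here refl)         z∈ = All.lookup (All.tail X∉) z∈ refl
    fresh (there (here refl)) z∈ = All.lookup Y∉ z∈ refl

    shared : ∀ {p q Z} → p ∈ (X , Y) ∷ 𝒜 → q ∈ (X , Y) ∷ 𝒜 →
             Z ∈ ends p → Z ∈ ends q → p ≡ q
    shared (here refl) (here refl) _  _  = refl
    shared (here refl) (there m₂)  z₁ z₂ = ⊥-elim (fresh z₁ (port∈usedPorts m₂ z₂))
    shared (there m₁)  (here refl) z₁ z₂ = ⊥-elim (fresh z₂ (port∈usedPorts m₁ z₁))
    shared (there m₁)  (there m₂)  z₁ z₂ = monogamous-shared-port mono m₁ m₂ z₁ z₂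

  representative : Arrangement α → Fin (len α) → Fin (len α)
  representative []             i = i
  representative ((X , Y) ∷ 𝒜) i with Y Fin.≟ i
  ... | yes _ = X
  ... | no  _ = representative 𝒜 i

  representative-spec : ∀ 𝒜 i → representative 𝒜 i ≡ i ⊎ (representative 𝒜 i , i) ∈ 𝒜
  representative-spec []             i = inj₁ refl
  representative-spec ((X , Y) ∷ 𝒜) i with Y Fin.≟ i
  ... | yes refl = inj₂ (here refl)
  ... | no  _    with representative-spec 𝒜 i
  ...   | inj₁ eq = inj₁ eq
  ...   | inj₂ m  = inj₂ (there m)

  representative-allocated : ∀ 𝒜 {X Y} → (X , Y) ∈ 𝒜 → (representative 𝒜 Y , Y) ∈ 𝒜
  representative-allocated ((X′ , Y′) ∷ 𝒜) {Y = Y} m with Y′ Fin.≟ Y | m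
  ... | yes refl | _         = here refl
  ... | no Y′≢Y  | here refl = ⊥-elim (Y′≢Y refl)
  ... | no _     | there m′  = there (representative-allocated 𝒜 m′)

  representative-type : ∀ {𝒜} → All (IsAllocation α) 𝒜 →
                        ∀ i → portType α (representative 𝒜 i) ≡ portType α i
  representative-type {𝒜} alloc i with representative-spec 𝒜 i
  ... | inj₁ eq = cong (portType α) eq
  ... | inj₂ m  = proj₂ (proj₂ (All.lookup alloc m))

  representative-agrees : ∀ {𝒜} → Monogamous α 𝒜 → ∀ {X Y} → (X , Y) ∈ 𝒜 →
                          representative 𝒜 X ≡ representative 𝒜 Y
  representative-agrees {𝒜} mono {X} {Y} m = trans repX≡X (sym repY≡X)
    where
    repY≡X : representative 𝒜 Y ≡ X
    repY≡X = cong proj₁ (monogamous-shared-port mono (representative-allocated 𝒜 m) m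
                                                (there (here refl)) (there (here refl)))
    repX≡X : representative 𝒜 X ≡ X
    repX≡X with representative-spec 𝒜 X
    ... | inj₁ eq = eq
    ... | inj₂ m′ =
      cong proj₁ (monogamous-shared-port mono m′ m (there (here refl)) (here refl))

  representative-atMostTwice : ∀ {𝒜} → Monogamous α 𝒜 →
                               ∀ Q → AtMostTwo (λ i → representative 𝒜 i ≡ Q)
  representative-atMostTwice {𝒜} mono Q i j k ri rj rk =
    AtMostTwo-⊎ itself allocated i j k (fibre ri) (fibre rj) (fibre rk)
    where
    fibre : ∀ {i} → representative 𝒜 i ≡ Q → i ≡ Q ⊎ (Q , i) ∈ 𝒜
    fibre {i} r with representative-spec 𝒜 i
    ... | inj₁ eq = inj₁ (trans (sym eq) r)
    ... | inj₂ m  = inj₂ (subst (λ q → (q , i) ∈ 𝒜) r m)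

    itself : AtMostOne (_≡ Q)
    itself i j i≡Q j≡Q = trans i≡Q (sym j≡Q)

    allocated : AtMostOne (λ i → (Q , i) ∈ 𝒜)
    allocated i j mi mj =
      cong proj₂ (monogamous-shared-port mono mi mj (here refl) (here refl))

  trivial⇒naming : TrivialR α → Naming α ℕ
  trivial⇒naming (𝒜 , alloc , mono , trivializing) = record
    { names        = names
    ; typed        = typed
    ; atMostTwice  = atMostTwice
    ; tautological = λ v → trivializing (map v names) (consistent v)
    }
    where
    names : Vec ℕ (len α)
    names = tabulate (toℕ ∘ representative 𝒜)

    lookup-names : ∀ i → lookup names i ≡ toℕ (representative 𝒜 i)
    lookup-names = lookup∘tabulate (toℕ ∘ representative 𝒜)

    sameRepresentative : ∀ {i j} → lookup names i ≡ lookup names j →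
                         representative 𝒜 i ≡ representative 𝒜 j
    sameRepresentative {i} {j} eq =
      toℕ-injective (trans (sym (lookup-names i)) (trans eq (lookup-names j)))

    typed : ∀ i j → lookup names i ≡ lookup names j → portType α i ≡ portType α j
    typed i j eq = trans (sym (representative-type alloc i))
                         (trans (cong (portType α) (sameRepresentative eq))
                                (representative-type alloc j))

    atMostTwice : ∀ x → AtMostTwo (λ i → x ≡ lookup names i)
    atMostTwice x i j k xi xj xk =
      representative-atMostTwice {𝒜} mono (representative 𝒜 i) i j k refl
        (sameRepresentative (trans (sym xj) xi)) (sameRepresentative (trans (sym xk) xi))

    consistent : ∀ (v : ℕ → Bool) → ConsistentWith α (map v names) 𝒜
    consistent v = All.tabulate λ { {X , Y} m → ≤B-reflexive (begin
      lookup (map v names) X         ≡⟨ lookup-map X v names ⟩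
      v (lookup names X)             ≡⟨ cong v (lookup-names X) ⟩
      v (toℕ (representative 𝒜 X))  ≡⟨ cong (v ∘ toℕ) (representative-agrees mono m) ⟩
      v (toℕ (representative 𝒜 Y))  ≡⟨ cong v (lookup-names Y) ⟨
      v (lookup names Y)             ≡⟨ lookup-map Y v names ⟨
      lookup (map v names) Y         ∎) }
      where open ≡-Reasoning

module _ {α : Resource} {𝒩 : Set} (_≟𝒩_ : DecidableEquality 𝒩) (naming : Naming α 𝒩)
  where

  open Naming naming

  Matched : Fin (len α) × Fin (len α) → Set
  Matched (X , Y) = IsInput α X × IsOutput α Y × lookup names X ≡ lookup names Y

  matched? : Decidable Matched
  matched? (X , Y) =
    isInput? α X ×-dec isOutput? α Y ×-dec lookup names X ≟𝒩 lookup names Y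

  portPairs : List (Fin (len α) × Fin (len α))
  portPairs = cartesianProduct (allFin (len α)) (allFin (len α))

  arrangement : Arrangement α
  arrangement = filter matched? portPairs

  matched⇒∈ : ∀ {X Y} → Matched (X , Y) → (X , Y) ∈ arrangement
  matched⇒∈ {X} {Y} = ∈-filter⁺ matched? (∈-cartesianProduct⁺ (∈-allFin X) (∈-allFin Y))

  arrangement-matched : All Matched arrangement
  arrangement-matched = All.all-filter matched? portPairs

  arrangement-allocations : All (IsAllocation α) arrangement
  arrangement-allocations =
    All.map (λ { {X , Y} (X-in , Y-out , XY) → X-in , Y-out , typed X Y XY }) arrangement-matched

  matched-ends-unique : ∀ {p} → Matched p → Unique (ends p)
  matched-ends-unique (X-in , Y-out , _) =
    (input≢output α X-in Y-out All.∷ All.[]) ∷ All.[] ∷ []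

  matched-disjoint : ∀ {p q} → p ≢ q → Matched p → Matched q → Disjoint (ends p) (ends q)
  matched-disjoint {X , Y} {X′ , Y′} p≢q (X-in , Y-out , XY) (X′-in , Y′-out , X′Y′) =
    λ where
      (here refl , here refl) → p≢q (cong (X ,_)
        (AtMostTwo-third (atMostTwice _) refl XY X′Y′
                         (input≢output α X-in Y-out) (input≢output α X-in Y′-out)))
      (there (here refl) , there (here refl)) → p≢q (cong (_, Y)
        (AtMostTwo-third (atMostTwice _) refl (sym XY) (sym X′Y′)
                         (input≢output α X-in Y-out ∘ sym) (input≢output α X′-in Y-out ∘ sym)))
      (here refl , there (here refl)) → input≢output α X-in Y′-out refl
      (there (here refl) , here refl) → input≢output α X′-in Y-out refl
      (there (there ()) , _)
      (_ , there (there ()))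

  arrangement-monogamous : Monogamous α arrangement
  arrangement-monogamous = Unique.concat⁺
    (All.map⁺ (All.map matched-ends-unique arrangement-matched))
    (AllPairs.map⁺ (allPairs-filter⁺ matched? matched-disjoint
                      (Unique.cartesianProduct⁺ (Unique.allFin⁺ _) (Unique.allFin⁺ _))))

  arrangement-trivializing : Trivializing α arrangement
  arrangement-trivializing s consistent =
    ≤B-true (monotone α (map v names) s (SitLeq-intro (interface α) outputs inputs))
            (tautological v)
    where
    TrueInputNamed : 𝒩 → Fin (len α) → Set
    TrueInputNamed x j = IsInput α j × lookup names j ≡ x × lookup s j ≡ true

    trueInputNamed? : ∀ x → Decidable (TrueInputNamed x)
    trueInputNamed? x j =
      isInput? α j ×-dec lookup names j ≟𝒩 x ×-dec lookup s j Bool.≟ true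

    -- Consistency makes every output named x true as soon as an input named x is,
    -- so the situation induced by v lies below s.
    v : 𝒩 → Bool
    v x = isYes (any? (trueInputNamed? x))

    v-sound : ∀ {x} → v x ≡ true → Σ (Fin (len α)) (TrueInputNamed x)
    v-sound {x} vx = toWitness {a? = any? (trueInputNamed? x)} (Equivalence.from T-≡ vx)

    v-complete : ∀ {x} j → TrueInputNamed x j → v x ≡ true
    v-complete {x} j t =
      Equivalence.to T-≡ (fromWitness {a? = any? (trueInputNamed? x)} (j , t))

    outputs : ∀ i → IsOutput α i → lookup (map v names) i ≤B lookup s i
    outputs i i-out rewrite lookup-map i v names = ≤B-intro λ vi →
      let (j , j-in , ji , sj) = v-sound vi
      in  ≤B-true (All.lookup consistent (matched⇒∈ (j-in , i-out , ji))) sj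

    inputs : ∀ i → IsInput α i → lookup s i ≤B lookup (map v names) i
    inputs i i-in rewrite lookup-map i v names =
      ≤B-intro λ si → v-complete i (i-in , refl , si)

  naming⇒trivial : TrivialR α
  naming⇒trivial =
    arrangement , arrangement-allocations , arrangement-monogamous , arrangement-trivializing

naming⇒instance : ∀ C → Naming (clubsuit C) ℕ →
                  Σ Cirquent (λ A → BinaryTautology A × InstanceOf C A)
naming⇒instance C naming = relabelled , (binary , tautology) , σ , C≡σrelabelled
  where
  open Naming naming

  relabelled : Cirquent
  relabelled = cirq (arity C) (structure C) (relabelP (pool C) names)

  binary : Binary relabelled
  binary P = subst (_≤ 2) (sym (occPool-relabelP P (pool C) names))
                   (Equivalence.from (count≤2⇔AtMostTwo (P ℕ.≟_) names) (atMostTwice P))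

  tautology : Tautology relabelled
  tautology v =
    trans (cong (cirqVal (structure C)) (evalM-relabelP v (pool C) names)) (tautological v)

  typeOfName : ℕ → ℕ
  typeOfName n with any? (λ i → lookup names i ℕ.≟ n)
  ... | yes (i , _) = portType (clubsuit C) i
  ... | no  _       = 0

  typeOfName-names : ∀ i → typeOfName (lookup names i) ≡ portType (clubsuit C) i
  typeOfName-names i with any? (λ j → lookup names j ℕ.≟ lookup names i)
  ... | yes (j , j≡i) = typed j i j≡i
  ... | no  ∄         = ⊥-elim (∄ (i , refl))

  σ : Substitution
  σ n = lit true (typeOfName n)

  C≡σrelabelled : C ≡ applyC σ relabelled
  C≡σrelabelled = cong (cirq (arity C) (structure C)) (sym (applyP-relabelP σ (pool C) names
                    (map-≡-lookup (cong (lit true) ∘ typeOfName-names))))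

Name : Set
Name = ℕ × ℕ × ℕ

_≟Name_ : DecidableEquality Name
_≟Name_ = ≡-dec ℕ._≟_ (≡-dec ℕ._≟_ ℕ._≟_)

nameType : Name → ℕ
nameType = proj₂ ∘ proj₂

module _ (σ : Substitution) where

  -- The type component of a name is determined by the other two; it is recorded only to make
  -- typedness immediate.
  block : ℕ → (G : Formula) → Vec Name (size G)
  block a G = tabulate λ i → a , toℕ i , type (lookup (portsF G) i)

  namesF : (F : Formula) → Vec Name (size (applyF σ F))
  namesF (lit true  a) = block a (σ a)
  namesF (lit false a) = castNeg (σ a) (block a (σ a))
  namesF (F ∧ G)       = namesF F ++ namesF G
  namesF (F ∨ G)       = namesF F ++ namesF G

  namesP : (Fs : Vec Formula k) → Vec Name (sizeP (map (applyF σ) Fs))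
  namesP []       = []
  namesP (F ∷ Fs) = namesF F ++ namesP Fs

  lookup-block : ∀ a G i → lookup (block a G) i ≡ (a , toℕ i , type (lookup (portsF G) i))
  lookup-block a G = lookup∘tabulate _

  nameType-block : ∀ a G → map nameType (block a G) ≡ map type (portsF G)
  nameType-block a G = begin
    map nameType (block a G)                 ≡⟨ tabulate-∘ nameType _ ⟨
    tabulate (type ∘ lookup (portsF G))      ≡⟨ tabulate-∘ type (lookup (portsF G)) ⟩
    map type (tabulate (lookup (portsF G)))  ≡⟨ cong (map type) (tabulate∘lookup (portsF G)) ⟩
    map type (portsF G)                      ∎
    where open ≡-Reasoning

  nameType-namesF : ∀ F → map nameType (namesF F) ≡ map type (portsF (applyF σ F))
  nameType-namesF (lit true  a) = nameType-block a (σ a)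
  nameType-namesF (lit false a) = begin
    map nameType (castNeg (σ a) (block a (σ a)))
      ≡⟨ map-castNeg nameType (σ a) _ ⟩
    castNeg (σ a) (map nameType (block a (σ a)))
      ≡⟨ cong (castNeg (σ a)) (nameType-block a (σ a)) ⟩
    castNeg (σ a) (map type (portsF (σ a)))
      ≡⟨ types-neg (σ a) ⟨
    map type (portsF (neg (σ a)))
      ∎
    where open ≡-Reasoning
  nameType-namesF (F ∧ G) = map-≡-++⁺ (nameType-namesF F) (nameType-namesF G)
  nameType-namesF (F ∨ G) = map-≡-++⁺ (nameType-namesF F) (nameType-namesF G)

  nameType-namesP : ∀ (Fs : Vec Formula k) →
                    map nameType (namesP Fs) ≡ map type (portsP (map (applyF σ) Fs))
  nameType-namesP []       = refl
  nameType-namesP (F ∷ Fs) = map-≡-++⁺ (nameType-namesF F) (nameType-namesP Fs)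

  count-block : ∀ a G x b → count (x ≟Name_) (block a G) ≤ occ (proj₁ x) (lit b a)
  count-block a G x b with proj₁ x ℕ.≡ᵇ a in x≢a
  ... | true  = count≤1 (x ≟Name_) (block a G) λ i j xi xj →
                  toℕ-injective (cong (proj₁ ∘ proj₂)
                    (trans (sym (lookup-block a G i)) (trans (sym xi) (trans xj (lookup-block a G j)))))
  ... | false = ≤-reflexive (count≡0 (x ≟Name_) (block a G) λ i xi →
                  subst T x≢a (≡⇒≡ᵇ _ _ (cong proj₁ (trans xi (lookup-block a G i)))))

  count-namesF : ∀ x F → count (x ≟Name_) (namesF F) ≤ occ (proj₁ x) F
  count-namesF x (lit true  a) = count-block a (σ a) x true
  count-namesF x (lit false a) =
    subst (_≤ _) (sym (count-castNeg (x ≟Name_) (σ a) _)) (count-block a (σ a) x false)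
  count-namesF x (F ∧ G) =
    count-++-≤ (x ≟Name_) (namesF F) (namesF G) (count-namesF x F) (count-namesF x G)
  count-namesF x (F ∨ G) =
    count-++-≤ (x ≟Name_) (namesF F) (namesF G) (count-namesF x F) (count-namesF x G)

  count-namesP : ∀ x (Fs : Vec Formula k) →
                 count (x ≟Name_) (namesP Fs) ≤ occPool (proj₁ x) Fs
  count-namesP x []       = z≤n
  count-namesP x (F ∷ Fs) =
    count-++-≤ (x ≟Name_) (namesF F) (namesP Fs) (count-namesF x F) (count-namesP x Fs)

  valuation : (Name → Bool) → Model
  valuation v a = evalS (σ a) (map v (block a (σ a)))

  evalS-namesF : ∀ v F → evalS (applyF σ F) (map v (namesF F)) ≡ evalM (valuation v) F
  evalS-namesF v (lit true  a) = refl
  evalS-namesF v (lit false a) =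
    trans (cong (evalS (neg (σ a))) (map-castNeg v (σ a) _)) (evalS-neg (σ a) _)
  evalS-namesF v (F ∧ G) =
    trans (cong (evalS (applyF σ F ∧ applyF σ G)) (map-++ v (namesF F) (namesF G)))
          (trans (evalS-∧-++ (applyF σ F) (applyF σ G) _ _)
                 (cong₂ _&&_ (evalS-namesF v F) (evalS-namesF v G)))
  evalS-namesF v (F ∨ G) =
    trans (cong (evalS (applyF σ F ∨ applyF σ G)) (map-++ v (namesF F) (namesF G)))
          (trans (evalS-∨-++ (applyF σ F) (applyF σ G) _ _)
                 (cong₂ _||_ (evalS-namesF v F) (evalS-namesF v G)))

  evalP-namesP : ∀ v (Fs : Vec Formula k) →
                 evalP (map (applyF σ) Fs) (map v (namesP Fs)) ≡ map (evalM (valuation v)) Fs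
  evalP-namesP v []       = refl
  evalP-namesP v (F ∷ Fs) =
    trans (cong (evalP (map (applyF σ) (F ∷ Fs))) (map-++ v (namesF F) (namesP Fs)))
          (trans (evalP-∷-++ (applyF σ F) (map (applyF σ) Fs) _ _)
                 (cong₂ _∷_ (evalS-namesF v F) (evalP-namesP v Fs)))

  instance⇒naming : ∀ A → BinaryTautology A → Naming (clubsuit (applyC σ A)) Name
  instance⇒naming A (binary , tautology) = record
    { names        = namesP (pool A)
    ; typed        = λ i j eq → trans (sym (nameType-lookup i))
                                      (trans (cong nameType eq) (nameType-lookup j))
    ; atMostTwice  = λ x → Equivalence.to (count≤2⇔AtMostTwo (x ≟Name_) (namesP (pool A)))
                                          (≤-trans (count-namesP x (pool A)) (binary (proj₁ x)))
    ; tautological = λ v → subst (λ b → cirqVal (structure A) b ≡ true)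
                                 (sym (evalP-namesP v (pool A))) (tautology (valuation v))
    }
    where
    nameType-lookup : ∀ i → nameType (lookup (namesP (pool A)) i)
                          ≡ type (lookup (portsP (map (applyF σ) (pool A))) i)
    nameType-lookup = lookup-≡-map (nameType-namesP (pool A))

lemma8p12 : (C : Cirquent) →
    Trivial C ⇔ Σ Cirquent (λ A → BinaryTautology A × InstanceOf C A)
lemma8p12 C = mk⇔ (naming⇒instance C ∘ trivial⇒naming)
                  λ { (A , binaryTautology , σ , refl) →
                        naming⇒trivial _≟Name_ (instance⇒naming σ A binaryTautology) }
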